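{- Let $n$ be a positive integer, $A$ a Boolean algebra and $X\subseteq A$. If $A$ is $n$-free over $X$, then $X^+=X\smallsetminus\{0\}$ is $n$-independent.
   Context: For nontrivial Boolean algebras $A,B$ and $U\subseteq A$, a function $f:U\to B$ is $n$-preserving if for all $a_0,\dots,a_{n-1}\in U$, $\prod_{i<n}a_i=0$ implies $\prod_{i<n}f(a_i)=0$. $A$ is $n$-free over $X$ if every $n$-preserving function from $X$ into an arbitrary nontrivial Boolean algebra $B$ extends to a unique homomorphism $A\to B$. A subset $X\subseteq A$ is $n$-independent if $0\notin X$ and for all nonempty finite $F,G\subseteq X$: $(\perp1)$ $\sum F\neq1$; $(\perp2)_n$ if $\prod F=0$ then there is $F'\subseteq F$ with $|F'|\le n$ and $\prod F'=0$; $(\perp3)$ if $0\neq\prod F\le\sum G$ then $F\cap G\neq\emptyset$. -}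

module Defs where

open import Level using (Level; _⊔_; Setω) renaming (suc to lsuc)
open import Data.Nat using (ℕ; suc; _≤_)
open import Data.Fin using (Fin; zero; suc)
open import Data.Product using (Σ; Σ-syntax; ∃; ∃-syntax; _×_; _,_; proj₁; proj₂)
open import Function using (_∘_)
open import Relation.Nullary using () renaming (¬_ to Not)
open import Relation.Unary using (Pred)
open import Algebra.Lattice.Bundles using (BooleanAlgebra)

private
  variable
    a b ℓa ℓb ℓx : Level

-- Finite meets and joins of a finite family (Fin k → Carrier).
-- A finite subset {a_0,…,a_{k-1}} is rendered as an indexed family; repetitions
-- do not affect meets/joins.
module Ops (A : BooleanAlgebra a ℓa) where
  open BooleanAlgebra A

  ⋀ : ∀ {k} → (Fin k → Carrier) → Carrier
  ⋀ {ℕ.zero} f = ⊤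
  ⋀ {suc k}  f = f zero ∧ ⋀ (f ∘ suc)

  ⋁ : ∀ {k} → (Fin k → Carrier) → Carrier
  ⋁ {ℕ.zero} f = ⊥
  ⋁ {suc k}  f = f zero ∨ ⋁ (f ∘ suc)

Nontrivial : BooleanAlgebra a ℓa → Set ℓa
Nontrivial A = Not (⊤ ≈ ⊥)
  where open BooleanAlgebra A

record IsBAHom (A : BooleanAlgebra a ℓa) (B : BooleanAlgebra b ℓb)
               (h : BooleanAlgebra.Carrier A → BooleanAlgebra.Carrier B)
               : Set (a ⊔ ℓa ⊔ ℓb) where
  private
    module A = BooleanAlgebra A
    module B = BooleanAlgebra B
  field
    cong   : ∀ {x y} → x A.≈ y → h x B.≈ h y
    hom-∨  : ∀ x y → h (x A.∨ y) B.≈ (h x B.∨ h y)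
    hom-∧  : ∀ x y → h (x A.∧ y) B.≈ (h x B.∧ h y)
    hom-¬  : ∀ x → h (A.¬ x) B.≈ (B.¬ (h x))
    hom-⊤  : h A.⊤ B.≈ B.⊤
    hom-⊥  : h A.⊥ B.≈ B.⊥

El : {A : BooleanAlgebra a ℓa} → Pred (BooleanAlgebra.Carrier A) ℓx → Set (a ⊔ ℓx)
El {A = A} U = Σ (BooleanAlgebra.Carrier A) U

NPreserving : (n : ℕ) (A : BooleanAlgebra a ℓa) (B : BooleanAlgebra b ℓb)
              (U : Pred (BooleanAlgebra.Carrier A) ℓx)
              (f : El {A = A} U → BooleanAlgebra.Carrier B) → Set (a ⊔ ℓa ⊔ ℓb ⊔ ℓx)
NPreserving n A B U f =
  (as : Fin n → El {A = A} U) →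
  Ops.⋀ A (proj₁ ∘ as) A.≈ A.⊥ →
  Ops.⋀ B (f ∘ as) B.≈ B.⊥
  where
    module A = BooleanAlgebra A
    module B = BooleanAlgebra B

Extends : (A : BooleanAlgebra a ℓa) (B : BooleanAlgebra b ℓb)
          (U : Pred (BooleanAlgebra.Carrier A) ℓx)
          (f : El {A = A} U → BooleanAlgebra.Carrier B)
          (h : BooleanAlgebra.Carrier A → BooleanAlgebra.Carrier B) → Set (a ⊔ ℓb ⊔ ℓx)
Extends A B U f h = (u : El {A = A} U) → h (proj₁ u) B.≈ f u
  where module B = BooleanAlgebra B

NFree : (n : ℕ) (A : BooleanAlgebra a ℓa) (X : Pred (BooleanAlgebra.Carrier A) ℓx) → Setω
NFree {a = a} {ℓa = ℓa} n A X =
  ∀ {b ℓb} (B : BooleanAlgebra b ℓb) → Nontrivial B →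
  (f : El {A = A} X → BooleanAlgebra.Carrier B) →
  (∀ {u v : El {A = A} X} → proj₁ u A.≈ proj₁ v → BooleanAlgebra._≈_ B (f u) (f v)) →
  NPreserving n A B X f →
  Σ (BooleanAlgebra.Carrier A → BooleanAlgebra.Carrier B) λ h →
    IsBAHom A B h × Extends A B X f h ×
    (∀ h' → IsBAHom A B h' → Extends A B X f h' →
       ∀ x → BooleanAlgebra._≈_ B (h' x) (h x))
  where
    module A = BooleanAlgebra A

Plus : (A : BooleanAlgebra a ℓa) → Pred (BooleanAlgebra.Carrier A) ℓx →
       Pred (BooleanAlgebra.Carrier A) (ℓa ⊔ ℓx)
Plus A X x = X x × Not (x ≈ ⊥)
  where open BooleanAlgebra A

-- X is n-independent: 0 ∉ X and for all nonempty finite F, G ⊆ X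
-- (families indexed by Fin (suc k), Fin (suc m)):
--  (⊥1) ∑F ≠ 1;
--  (⊥2)_n if ∏F = 0 then some F' ⊆ F with |F'| ≤ n has ∏F' = 0;
--  (⊥3) if 0 ≠ ∏F ≤ ∑G then F ∩ G ≠ ∅.
NIndependent : (n : ℕ) (A : BooleanAlgebra a ℓa) (X : Pred (BooleanAlgebra.Carrier A) ℓx) →
               Set (a ⊔ ℓa ⊔ ℓx)
NIndependent n A X =
  Not (X ⊥) ×
  (∀ {k} (F : Fin (suc k) → Carrier) → (∀ i → X (F i)) → Not (⋁ F ≈ ⊤)) ×
  (∀ {k} (F : Fin (suc k) → Carrier) → (∀ i → X (F i)) → ⋀ F ≈ ⊥ →
     Σ[ m ∈ ℕ ] Σ[ ι ∈ (Fin m → Fin (suc k)) ] m ≤ n × ⋀ (F ∘ ι) ≈ ⊥) ×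
  (∀ {k m} (F : Fin (suc k) → Carrier) (G : Fin (suc m) → Carrier) →
     (∀ i → X (F i)) → (∀ j → X (G j)) →
     Not (⋀ F ≈ ⊥) → ⋀ F ≤A ⋁ G →
     ∃[ i ] ∃[ j ] F i ≈ G j)
  where
    open BooleanAlgebra A
    open Ops A
    _≤A_ : Carrier → Carrier → Set _
    x ≤A y = (x ∧ y) ≈ x

-- Classically one tests each clause of n-independence against suitable
-- 2-valued maps X → 2.  Constructively the clauses (⊥2) and (⊥3) must produce
-- witnesses, so we replace 2 by the algebra  Props G  of propositions up to
-- G-equivalence (P ≈ Q iff P → G and Q → G are interderivable), where G is the
-- goal we want to prove: a valuation showing "P ≈ ⊥" in Props G for an
-- inhabited P yields G itself.  Props G is trivial exactly when G holds, so
-- instead of feeding it to n-freeness directly we use the nontrivial product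
-- A × Props G and project (lemma  extend).
module Submission where

open import Defs
open import Level using (Level; _⊔_) renaming (suc to lsuc)
open import Data.Nat using (ℕ; suc; NonZero; _≤_)
open import Data.Nat.Properties using (≤-refl)
open import Data.Fin using (Fin; zero; suc)
open import Data.Product using (Σ; Σ-syntax; ∃-syntax; _×_; _,_; proj₁; proj₂)
open import Data.Sum using (_⊎_; inj₁; inj₂)
open import Data.Unit.Polymorphic using (tt) renaming (⊤ to 𝟙)
open import Data.Empty using () renaming (⊥ to Empty)
open import Data.Empty.Polymorphic using () renaming (⊥ to 𝟘)
open import Function using (_∘_)
open import Relation.Nullary using (contradiction) renaming (¬_ to Not)
open import Relation.Unary using (Pred)
open import Algebra.Lattice.Bundles using (BooleanAlgebra)
import Algebra.Lattice.Properties.BooleanAlgebra as BooleanAlgebraProperties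
import Relation.Binary.Reasoning.Setoid as SetoidReasoning

private
  variable
    a b c ℓa ℓb ℓc g : Level

_×-BA_ : BooleanAlgebra a ℓa → BooleanAlgebra b ℓb → BooleanAlgebra (a ⊔ b) (ℓa ⊔ ℓb)
A ×-BA B = record
  { Carrier = A.Carrier × B.Carrier
  ; _≈_ = λ (x , y) (x' , y') → (x A.≈ x') × (y B.≈ y')
  ; _∨_ = λ (x , y) (x' , y') → (x A.∨ x') , (y B.∨ y')
  ; _∧_ = λ (x , y) (x' , y') → (x A.∧ x') , (y B.∧ y')
  ; ¬_ = λ (x , y) → (A.¬ x) , (B.¬ y)
  ; ⊤ = A.⊤ , B.⊤
  ; ⊥ = A.⊥ , B.⊥
  ; isBooleanAlgebra = record
    { isDistributiveLattice = record
      { isLattice = record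
        { isEquivalence = record
          { refl = A.refl , B.refl
          ; sym = λ (p , q) → A.sym p , B.sym q
          ; trans = λ (p , q) (p' , q') → A.trans p p' , B.trans q q'
          }
        ; ∨-comm = λ _ _ → A.∨-comm _ _ , B.∨-comm _ _
        ; ∨-assoc = λ _ _ _ → A.∨-assoc _ _ _ , B.∨-assoc _ _ _
        ; ∨-cong = λ (p , q) (p' , q') → A.∨-cong p p' , B.∨-cong q q'
        ; ∧-comm = λ _ _ → A.∧-comm _ _ , B.∧-comm _ _
        ; ∧-assoc = λ _ _ _ → A.∧-assoc _ _ _ , B.∧-assoc _ _ _
        ; ∧-cong = λ (p , q) (p' , q') → A.∧-cong p p' , B.∧-cong q q'
        ; absorptive = (λ _ _ → A.∨-absorbs-∧ _ _ , B.∨-absorbs-∧ _ _)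
                     , (λ _ _ → A.∧-absorbs-∨ _ _ , B.∧-absorbs-∨ _ _)
        }
      ; ∨-distrib-∧ = (λ _ _ _ → A.∨-distribˡ-∧ _ _ _ , B.∨-distribˡ-∧ _ _ _)
                    , (λ _ _ _ → A.∨-distribʳ-∧ _ _ _ , B.∨-distribʳ-∧ _ _ _)
      ; ∧-distrib-∨ = (λ _ _ _ → A.∧-distribˡ-∨ _ _ _ , B.∧-distribˡ-∨ _ _ _)
                    , (λ _ _ _ → A.∧-distribʳ-∨ _ _ _ , B.∧-distribʳ-∨ _ _ _)
      }
    ; ∨-complement = (λ _ → A.∨-complementˡ _ , B.∨-complementˡ _)
                   , (λ _ → A.∨-complementʳ _ , B.∨-complementʳ _)
    ; ∧-complement = (λ _ → A.∧-complementˡ _ , B.∧-complementˡ _)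
                   , (λ _ → A.∧-complementʳ _ , B.∧-complementʳ _)
    ; ¬-cong = λ (p , q) → A.¬-cong p , B.¬-cong q
    }
  }
  where module A = BooleanAlgebra A
        module B = BooleanAlgebra B

module _ (A : BooleanAlgebra a ℓa) (B : BooleanAlgebra b ℓb) where
  private
    module A = BooleanAlgebra A
    module B = BooleanAlgebra B

  proj₁-hom : IsBAHom (A ×-BA B) A proj₁
  proj₁-hom = record
    { cong = proj₁ ; hom-∨ = λ _ _ → A.refl ; hom-∧ = λ _ _ → A.refl
    ; hom-¬ = λ _ → A.refl ; hom-⊤ = A.refl ; hom-⊥ = A.refl }

  proj₂-hom : IsBAHom (A ×-BA B) B proj₂
  proj₂-hom = record
    { cong = proj₂ ; hom-∨ = λ _ _ → B.refl ; hom-∧ = λ _ _ → B.refl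
    ; hom-¬ = λ _ → B.refl ; hom-⊤ = B.refl ; hom-⊥ = B.refl }

∘-hom : {A : BooleanAlgebra a ℓa} {B : BooleanAlgebra b ℓb} {C : BooleanAlgebra c ℓc}
        {k : BooleanAlgebra.Carrier B → BooleanAlgebra.Carrier C}
        {h : BooleanAlgebra.Carrier A → BooleanAlgebra.Carrier B} →
        IsBAHom B C k → IsBAHom A B h → IsBAHom A C (k ∘ h)
∘-hom {C = C} hk hh = record
  { cong = K.cong ∘ H.cong
  ; hom-∨ = λ x y → C.trans (K.cong (H.hom-∨ x y)) (K.hom-∨ _ _)
  ; hom-∧ = λ x y → C.trans (K.cong (H.hom-∧ x y)) (K.hom-∧ _ _)
  ; hom-¬ = λ x → C.trans (K.cong (H.hom-¬ x)) (K.hom-¬ _)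
  ; hom-⊤ = C.trans (K.cong H.hom-⊤) K.hom-⊤
  ; hom-⊥ = C.trans (K.cong H.hom-⊥) K.hom-⊥
  }
  where module C = BooleanAlgebra C
        module K = IsBAHom hk
        module H = IsBAHom hh

module FiniteOps (B : BooleanAlgebra b ℓb) where
  open BooleanAlgebra B
  open Ops B

  ⋀-cong : ∀ {k} {f f' : Fin k → Carrier} → (∀ i → f i ≈ f' i) → ⋀ f ≈ ⋀ f'
  ⋀-cong {ℕ.zero} _ = refl
  ⋀-cong {suc k}  e = ∧-cong (e zero) (⋀-cong (e ∘ suc))

  ⋁-cong : ∀ {k} {f f' : Fin k → Carrier} → (∀ i → f i ≈ f' i) → ⋁ f ≈ ⋁ f'
  ⋁-cong {ℕ.zero} _ = refl
  ⋁-cong {suc k}  e = ∨-cong (e zero) (⋁-cong (e ∘ suc))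

module _ {A : BooleanAlgebra a ℓa} {B : BooleanAlgebra b ℓb}
         {h : BooleanAlgebra.Carrier A → BooleanAlgebra.Carrier B}
         (hom : IsBAHom A B h) where
  private
    module B = BooleanAlgebra B
  open IsBAHom hom

  hom-⋀ : ∀ {k} (xs : Fin k → BooleanAlgebra.Carrier A) → h (Ops.⋀ A xs) B.≈ Ops.⋀ B (h ∘ xs)
  hom-⋀ {ℕ.zero} _  = hom-⊤
  hom-⋀ {suc k}  xs = B.trans (hom-∧ _ _) (B.∧-cong B.refl (hom-⋀ (xs ∘ suc)))

  hom-⋁ : ∀ {k} (xs : Fin k → BooleanAlgebra.Carrier A) → h (Ops.⋁ A xs) B.≈ Ops.⋁ B (h ∘ xs)
  hom-⋁ {ℕ.zero} _  = hom-⊥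
  hom-⋁ {suc k}  xs = B.trans (hom-∨ _ _) (B.∨-cong B.refl (hom-⋁ (xs ∘ suc)))

record Extension (A : BooleanAlgebra a ℓa) (B : BooleanAlgebra b ℓb)
                 {ℓx} (X : Pred (BooleanAlgebra.Carrier A) ℓx)
                 (f : El {A = A} X → BooleanAlgebra.Carrier B) : Set (a ⊔ ℓa ⊔ b ⊔ ℓb ⊔ ℓx) where
  private
    module A = BooleanAlgebra A
    module B = BooleanAlgebra B
  field
    h   : A.Carrier → B.Carrier
    hom : IsBAHom A B h
    ext : Extends A B X f h
  open IsBAHom hom public

  ext-⋀ : ∀ {k} (us : Fin k → El {A = A} X) → h (Ops.⋀ A (proj₁ ∘ us)) B.≈ Ops.⋀ B (f ∘ us)
  ext-⋀ us = B.trans (hom-⋀ hom (proj₁ ∘ us)) (FiniteOps.⋀-cong B (ext ∘ us))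

  ext-⋁ : ∀ {k} (us : Fin k → El {A = A} X) → h (Ops.⋁ A (proj₁ ∘ us)) B.≈ Ops.⋁ B (f ∘ us)
  ext-⋁ us = B.trans (hom-⋁ hom (proj₁ ∘ us)) (FiniteOps.⋁-cong B (ext ∘ us))

module _ (G : Set g) where
  Neg : Set g → Set g
  Neg P = P → G

  Cont : Set g → Set g
  Cont P = Neg (Neg P)

  _≈ᴳ_ : Set g → Set g → Set g
  P ≈ᴳ Q = (Neg Q → Neg P) × (Neg P → Neg Q)

  private
    return : ∀ {P} → P → Cont P
    return p k = k p

    equiv : ∀ {P Q} → (P → Cont Q) → (Q → Cont P) → P ≈ᴳ Q
    equiv f f' = (λ nq p → f p nq) , (λ np q → f' q np)

    swap : ∀ {P Q : Set g} → P ⊎ Q → Cont (Q ⊎ P)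
    swap (inj₁ p) = return (inj₂ p)
    swap (inj₂ q) = return (inj₁ q)

  Props : BooleanAlgebra (lsuc g) g
  Props = record
    { Carrier = Set g
    ; _≈_ = _≈ᴳ_
    ; _∨_ = _⊎_
    ; _∧_ = _×_
    ; ¬_ = Neg
    ; ⊤ = 𝟙
    ; ⊥ = 𝟘
    ; isBooleanAlgebra = record
      { isDistributiveLattice = record
        { isLattice = record
          { isEquivalence = record
            { refl = (λ z → z) , (λ z → z)
            ; sym = λ (p , q) → q , p
            ; trans = λ (p , q) (p' , q') → p ∘ p' , q' ∘ q
            }
          ; ∨-comm = λ _ _ → equiv swap swap
          ; ∨-assoc = λ _ _ _ → equiv
              (λ { (inj₁ (inj₁ x)) → return (inj₁ x)
                 ; (inj₁ (inj₂ y)) → return (inj₂ (inj₁ y))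
                 ; (inj₂ z) → return (inj₂ (inj₂ z)) })
              (λ { (inj₁ x) → return (inj₁ (inj₁ x))
                 ; (inj₂ (inj₁ y)) → return (inj₁ (inj₂ y))
                 ; (inj₂ (inj₂ z)) → return (inj₂ z) })
          ; ∨-cong = λ (p , q) (p' , q') →
              (λ n → λ { (inj₁ x) → p (n ∘ inj₁) x ; (inj₂ y) → p' (n ∘ inj₂) y })
            , (λ n → λ { (inj₁ x) → q (n ∘ inj₁) x ; (inj₂ y) → q' (n ∘ inj₂) y })
          ; ∧-comm = λ _ _ → equiv (λ (x , y) → return (y , x)) (λ (y , x) → return (x , y))
          ; ∧-assoc = λ _ _ _ → equiv (λ ((x , y) , z) → return (x , (y , z)))
                                      (λ (x , (y , z)) → return ((x , y) , z))
          ; ∧-cong = λ (p , q) (p' , q') →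
              equiv (λ (x , y) k → p (λ x' → p' (λ y' → k (x' , y')) y) x)
                    (λ (x , y) k → q (λ x' → q' (λ y' → k (x' , y')) y) x)
          ; absorptive =
              (λ _ _ → equiv (λ { (inj₁ x) → return x ; (inj₂ (x , _)) → return x })
                             (return ∘ inj₁))
            , (λ _ _ → equiv (λ (x , _) → return x) (λ x → return (x , inj₁ x)))
          }
        ; ∨-distrib-∧ =
            (λ _ _ _ → equiv
              (λ { (inj₁ x) → return (inj₁ x , inj₁ x) ; (inj₂ (y , z)) → return (inj₂ y , inj₂ z) })
              (λ { (inj₁ x , _) → return (inj₁ x) ; (inj₂ _ , inj₁ x) → return (inj₁ x)
                 ; (inj₂ y , inj₂ z) → return (inj₂ (y , z)) }))
          , (λ _ _ _ → equiv
              (λ { (inj₂ x) → return (inj₂ x , inj₂ x) ; (inj₁ (y , z)) → return (inj₁ y , inj₁ z) })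
              (λ { (inj₂ x , _) → return (inj₂ x) ; (inj₁ _ , inj₂ x) → return (inj₂ x)
                 ; (inj₁ y , inj₁ z) → return (inj₁ (y , z)) }))
        ; ∧-distrib-∨ =
            (λ _ _ _ → equiv
              (λ { (x , inj₁ y) → return (inj₁ (x , y)) ; (x , inj₂ z) → return (inj₂ (x , z)) })
              (λ { (inj₁ (x , y)) → return (x , inj₁ y) ; (inj₂ (x , z)) → return (x , inj₂ z) }))
          , (λ _ _ _ → equiv
              (λ { (inj₁ y , x) → return (inj₁ (y , x)) ; (inj₂ z , x) → return (inj₂ (z , x)) })
              (λ { (inj₁ (y , x)) → return (inj₁ y , x) ; (inj₂ (z , x)) → return (inj₂ z , x) }))
        }
      ; ∨-complement = (λ _ → equiv (λ _ → return tt) (λ _ k → k (inj₁ (k ∘ inj₂))))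
                     , (λ _ → equiv (λ _ → return tt) (λ _ k → k (inj₂ (k ∘ inj₁))))
      ; ∧-complement = (λ _ → equiv (λ (nx , x) _ → nx x) (λ ()))
                     , (λ _ → equiv (λ (x , nx) _ → nx x) (λ ()))
      ; ¬-cong = λ (p , q) → (λ nny nx → nny (q nx)) , (λ nnx ny → nnx (p ny))
      }
    }

module PropsFacts (G : Set g) where
  open BooleanAlgebra (Props G)
  open Ops (Props G)

  ⋀-intro : ∀ {k} (P : Fin k → Set g) → (∀ i → P i) → ⋀ P
  ⋀-intro {ℕ.zero} _ _ = tt
  ⋀-intro {suc k}  P p = p zero , ⋀-intro (P ∘ suc) (p ∘ suc)

  ⋀-elim : ∀ {k} (P : Fin k → Set g) → ⋀ P → ∀ i → P i
  ⋀-elim P (p , _) zero    = p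
  ⋀-elim P (_ , r) (suc i) = ⋀-elim (P ∘ suc) r i

  ⋁-elim : ∀ {k} (P : Fin k → Set g) → ⋁ P → Σ (Fin k) P
  ⋁-elim {suc k} P (inj₁ p) = zero , p
  ⋁-elim {suc k} P (inj₂ r) with ⋁-elim (P ∘ suc) r
  ... | i , p = suc i , p

  ⇔⇒≈ : ∀ {P Q : Set g} → (P → Q) → (Q → P) → P ≈ Q
  ⇔⇒≈ f f' = (λ nq → nq ∘ f) , (λ np → np ∘ f')

  transport : ∀ {P Q} → P ≈ Q → P → Cont G Q
  transport (nq⇒np , _) p nq = nq⇒np nq p

  refute : ∀ {P} → P ≈ ⊥ → P → G
  refute e p = transport e p (λ ())

module Basics (A : BooleanAlgebra a ℓa) where
  open BooleanAlgebra A
  open Ops A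
  open FiniteOps A
  open BooleanAlgebraProperties A using (∧-identityʳ; ∧-zeroʳ; ∧-idem)
  open SetoidReasoning setoid

  nonzero⇒nontrivial : ∀ {x} → Not (x ≈ ⊥) → Nontrivial A
  nonzero⇒nontrivial {x} x≉⊥ ⊤≈⊥ = x≉⊥ (begin
    x      ≈⟨ ∧-identityʳ x ⟨
    x ∧ ⊤  ≈⟨ ∧-cong refl ⊤≈⊥ ⟩
    x ∧ ⊥  ≈⟨ ∧-zeroʳ x ⟩
    ⊥      ∎)

  ⋀-lowerBound : ∀ {k} (F : Fin k → Carrier) i → (⋀ F ∧ F i) ≈ ⋀ F
  ⋀-lowerBound F zero = begin
    (F zero ∧ R) ∧ F zero  ≈⟨ ∧-assoc _ _ _ ⟩
    F zero ∧ (R ∧ F zero)  ≈⟨ ∧-cong refl (∧-comm _ _) ⟩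
    F zero ∧ (F zero ∧ R)  ≈⟨ ∧-assoc _ _ _ ⟨
    (F zero ∧ F zero) ∧ R  ≈⟨ ∧-cong (∧-idem _) refl ⟩
    F zero ∧ R             ∎
    where R = ⋀ (F ∘ suc)
  ⋀-lowerBound F (suc i) = trans (∧-assoc _ _ _) (∧-cong refl (⋀-lowerBound (F ∘ suc) i))

  ⋀-sub : ∀ {k m} (F : Fin k → Carrier) (ι : Fin m → Fin k) → (⋀ F ∧ ⋀ (F ∘ ι)) ≈ ⋀ F
  ⋀-sub {m = ℕ.zero} F ι = ∧-identityʳ _
  ⋀-sub {m = suc m}  F ι = begin
    ⋀ F ∧ (F (ι zero) ∧ R)  ≈⟨ ∧-assoc _ _ _ ⟨
    (⋀ F ∧ F (ι zero)) ∧ R  ≈⟨ ∧-cong (⋀-lowerBound F (ι zero)) refl ⟩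
    ⋀ F ∧ R                 ≈⟨ ⋀-sub F (ι ∘ suc) ⟩
    ⋀ F                     ∎
    where R = ⋀ (F ∘ ι ∘ suc)

  ⋀-sub-⊥ : ∀ {k m} (F : Fin k → Carrier) (ι : Fin m → Fin k) → ⋀ (F ∘ ι) ≈ ⊥ → ⋀ F ≈ ⊥
  ⋀-sub-⊥ F ι e = begin
    ⋀ F              ≈⟨ ⋀-sub F ι ⟨
    ⋀ F ∧ ⋀ (F ∘ ι)  ≈⟨ ∧-cong refl e ⟩
    ⋀ F ∧ ⊥          ≈⟨ ∧-zeroʳ _ ⟩
    ⊥                ∎

  _∈ᶠ_ : ∀ {k} → Carrier → (Fin k → Carrier) → Set ℓa
  x ∈ᶠ F = Σ[ i ∈ Fin _ ] x ≈ F i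

  ∈ᶠ-resp : ∀ {k} {F : Fin k → Carrier} {x y} → x ≈ y → x ∈ᶠ F → y ∈ᶠ F
  ∈ᶠ-resp x≈y (i , x≈Fi) = i , trans (sym x≈y) x≈Fi

  members : ∀ {ℓx} {X : Pred Carrier ℓx} {k} (F : Fin k → Carrier) →
            (∀ i → Plus A X (F i)) → Fin k → El {A = A} X
  members F XF i = F i , proj₁ (XF i)

  module Free {ℓx} (X : Pred Carrier ℓx) (n : ℕ) (free : NFree n A X)
              (nontrivial : Nontrivial A) where

    -- Over a nontrivial A, n-freeness yields extensions into ANY Boolean
    -- algebra B, trivial or not: extend  u ↦ (u , f u)  into A × B and
    -- project to B.
    extend : (B : BooleanAlgebra b ℓb) (f : El {A = A} X → BooleanAlgebra.Carrier B) →
             (∀ {u v : El {A = A} X} → proj₁ u ≈ proj₁ v → BooleanAlgebra._≈_ B (f u) (f v)) →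
             NPreserving n A B X f →
             Extension A B X f
    extend B f f-cong f-pres =
      let (H , H-hom , H-ext , _) = free (A ×-BA B) (nontrivial ∘ proj₁) pair
                                      (λ e → e , f-cong e) pair-pres
      in record { h = proj₂ ∘ H ; hom = ∘-hom (proj₂-hom A B) H-hom ; ext = proj₂ ∘ H-ext }
      where
        pair : El {A = A} X → Carrier × BooleanAlgebra.Carrier B
        pair u = proj₁ u , f u
        pair-pres : NPreserving n A (A ×-BA B) X pair
        pair-pres us e = trans (hom-⋀ (proj₁-hom A B) (pair ∘ us)) e
                       , BooleanAlgebra.trans B (hom-⋀ (proj₂-hom A B) (pair ∘ us)) (f-pres us e)

    valuation : (G : Set g) (v : El {A = A} X → Set g) →
                (∀ {u w : El {A = A} X} → proj₁ u ≈ proj₁ w → v u → v w) →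
                (∀ (us : Fin n → El {A = A} X) → ⋀ (proj₁ ∘ us) ≈ ⊥ → (∀ t → v (us t)) → G) →
                Extension A (Props G) X v
    valuation G v v-resp v-pres =
      extend (Props G) v (λ e → ⇔⇒≈ (v-resp e) (v-resp (sym e)))
             (λ us e → (λ _ vs → v-pres us e (⋀-elim (v ∘ us) vs)) , (λ _ ()))
      where open PropsFacts G

    membership : ∀ {k} (F : Fin k → Carrier) (G : Set ℓa) →
                 (∀ (ι : Fin n → Fin k) → ⋀ (F ∘ ι) ≈ ⊥ → G) →
                 Extension A (Props G) X (λ u → proj₁ u ∈ᶠ F)
    membership F G subfamily⇒G = valuation G (λ u → proj₁ u ∈ᶠ F) ∈ᶠ-resp
      λ us ⋀us≈⊥ us∈F → subfamily⇒G (proj₁ ∘ us∈F)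
        (trans (⋀-cong (λ t → sym (proj₂ (us∈F t)))) ⋀us≈⊥)

-- For n ≥ 1, Fin n is inhabited; so n false statements jointly imply falsity.
someIndex : ∀ n → .{{NonZero n}} → Fin n
someIndex (suc _) = zero

module Clauses (A : BooleanAlgebra a ℓa) {ℓx} (n : ℕ) (X : Pred (BooleanAlgebra.Carrier A) ℓx)
               (free : NFree n A X) where
  open BooleanAlgebra A
  open Ops A
  open Basics A
  open Basics.Free A X n free using (valuation; membership)

  nontrivial : ∀ {k} {F : Fin (suc k) → Carrier} → (∀ i → Plus A X (F i)) → Nontrivial A
  nontrivial XF = nonzero⇒nontrivial (proj₂ (XF zero))

  -- (⊥1): for n ≥ 1 the constantly false valuation is n-preserving; its
  -- extension V makes V(⋁F) false but V(1) true.
  join-≉⊤ : .{{_ : NonZero n}} → ∀ {k} (F : Fin (suc k) → Carrier) →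
            (∀ i → Plus A X (F i)) → Not (⋁ F ≈ ⊤)
  join-≉⊤ {k} F XF ⋁F≈⊤ = transport ⊤≈⋁false tt (proj₂ ∘ ⋁-elim false)
    where
      open PropsFacts Empty
      module P = BooleanAlgebra (Props Empty)
      open Extension (valuation (nontrivial XF) Empty (λ _ → Empty) (λ _ ())
                        (λ _ _ false → false (someIndex n)))
      false : Fin (suc k) → Set
      false _ = Empty
      ⊤≈⋁false : P.⊤ P.≈ Ops.⋁ (Props Empty) false
      ⊤≈⋁false = P.trans (P.sym hom-⊤) (P.trans (cong (sym ⋁F≈⊤)) (ext-⋁ (members F XF)))

  -- (⊥2): take G = "some ≤ n members of F have meet 0".  The membership
  -- valuation extends to V with V(⋀F) inhabited, yet V(⋀F) = V(0) = ⊥.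
  meet-⊥-small : ∀ {k} (F : Fin (suc k) → Carrier) → (∀ i → Plus A X (F i)) → ⋀ F ≈ ⊥ →
                 Σ[ m ∈ ℕ ] Σ[ ι ∈ (Fin m → Fin (suc k)) ] m ≤ n × ⋀ (F ∘ ι) ≈ ⊥
  meet-⊥-small {k} F XF ⋀F≈⊥ = refute ⋀members≈⊥ (⋀-intro (λ i → F i ∈ᶠ F) (λ i → i , refl))
    where
      Goal = Σ[ m ∈ ℕ ] Σ[ ι ∈ (Fin m → Fin (suc k)) ] m ≤ n × ⋀ (F ∘ ι) ≈ ⊥
      open PropsFacts Goal
      module P = BooleanAlgebra (Props Goal)
      open Extension (membership (nontrivial XF) F Goal (λ ι e → n , ι , ≤-refl , e))
      ⋀members≈⊥ : Ops.⋀ (Props Goal) (λ i → F i ∈ᶠ F) P.≈ P.⊥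
      ⋀members≈⊥ = P.trans (P.sym (ext-⋀ (members F XF))) (P.trans (cong ⋀F≈⊥) hom-⊥)

  -- (⊥3): take G = "some F i equals some Gs j".  If ⋀F ≠ 0, no subfamily of
  -- F has meet 0, so the membership valuation extends to V; then
  -- V(⋀F) = V(⋀F) × V(⋁Gs), and V(⋀F) is inhabited, so some Gs j is in F.
  meet-below-join : ∀ {k m} (F : Fin (suc k) → Carrier) (Gs : Fin (suc m) → Carrier) →
                    (∀ i → Plus A X (F i)) → (∀ j → Plus A X (Gs j)) →
                    Not (⋀ F ≈ ⊥) → (⋀ F ∧ ⋁ Gs) ≈ ⋀ F →
                    ∃[ i ] ∃[ j ] F i ≈ Gs j
  meet-below-join F Gs XF XGs ⋀F≉⊥ ⋀F≤⋁Gs =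
    transport ⋀members≈meet∧join (⋀-intro (λ i → F i ∈ᶠ F) (λ i → i , refl)) found
    where
      Goal = ∃[ i ] ∃[ j ] F i ≈ Gs j
      open PropsFacts Goal
      module P = BooleanAlgebra (Props Goal)
      open Extension (membership (nontrivial XF) F Goal
                        (λ ι ⋀Fι≈⊥ → contradiction (⋀-sub-⊥ F ι ⋀Fι≈⊥) ⋀F≉⊥))
      ⋀members≈meet∧join : Ops.⋀ (Props Goal) (λ i → F i ∈ᶠ F) P.≈
                           (Ops.⋀ (Props Goal) (λ i → F i ∈ᶠ F) × Ops.⋁ (Props Goal) (λ j → Gs j ∈ᶠ F))
      ⋀members≈meet∧join =
        P.trans (P.sym (ext-⋀ (members F XF)))
        (P.trans (cong (sym ⋀F≤⋁Gs))
        (P.trans (hom-∧ _ _)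
                 (P.∧-cong (ext-⋀ (members F XF)) (ext-⋁ (members Gs XGs)))))
      found : Ops.⋀ (Props Goal) (λ i → F i ∈ᶠ F) × Ops.⋁ (Props Goal) (λ j → Gs j ∈ᶠ F) → Goal
      found (_ , Gs∈F) with ⋁-elim (λ j → Gs j ∈ᶠ F) Gs∈F
      ... | j , i , Gsj≈Fi = i , j , sym Gsj≈Fi

mainTheorem2 : ∀ {a ℓa ℓx} (n : ℕ) → .{{_ : NonZero n}} →
    (A : BooleanAlgebra a ℓa) (X : Pred (BooleanAlgebra.Carrier A) ℓx) →
    NFree n A X → NIndependent n A (Plus A X)
mainTheorem2 n A X free =
  (λ (_ , 0≉0) → 0≉0 (BooleanAlgebra.refl A)) , join-≉⊤ , meet-⊥-small , meet-below-join
  where open Clauses A n X free
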